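{- The category $\mathbf{Ucwf}$ has an initial object.
   Context: A unityped category with families (ucwf) consists of: a category $\mathcal{C}$ with a chosen terminal object $0$; a presheaf $\mathrm{Tm}:\mathcal{C}^{\mathrm{op}}\to\mathrm{Set}$ (for $\gamma:n\to m$ and $a\in\mathrm{Tm}(m)$ write $a[\gamma]\in\mathrm{Tm}(n)$); and for each object $n$ a chosen object $s(n)$, morphism $\mathrm{p}_n:s(n)\to n$ and term $\mathrm{q}_n\in\mathrm{Tm}(s(n))$ such that for all $\gamma:m\to n$ and $a\in\mathrm{Tm}(m)$ there is a unique $\langle\gamma,a\rangle:m\to s(n)$ with $\mathrm{p}_n\circ\langle\gamma,a\rangle=\gamma$ and $\mathrm{q}_n[\langle\gamma,a\rangle]=a$. A strict morphism of ucwfs $(\mathcal{C},\mathrm{Tm})\to(\mathcal{D},\mathrm{Tm}')$ is a functor $F$ with $F(0)=0$ and a natural transformation $\sigma_n:\mathrm{Tm}(n)\to\mathrm{Tm}'(Fn)$ such that $F(s(n))=s(Fn)$, $F(\mathrm{p}_n)=\mathrm{p}_{Fn}$, $\sigma_{s(n)}(\mathrm{q}_n)=\mathrm{q}_{Fn}$. $\mathbf{Ucwf}$ is the category of small ucwfs and strict morphisms. -}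

module Defs where

open import Level using (0ℓ) renaming (suc to lsuc)
open import Data.Product using (Σ; _,_)
open import Relation.Binary.PropositionalEquality using (_≡_; subst; subst₂)

record Category : Set₁ where
  infixr 9 _∘_
  field
    Obj   : Set
    Hom   : Obj → Obj → Set
    id    : ∀ {a} → Hom a a
    _∘_   : ∀ {a b c} → Hom b c → Hom a b → Hom a c
    idˡ   : ∀ {a b} (f : Hom a b) → id ∘ f ≡ f
    idʳ   : ∀ {a b} (f : Hom a b) → f ∘ id ≡ f
    assoc : ∀ {a b c d} (h : Hom c d) (g : Hom b c) (f : Hom a b) →
            (h ∘ g) ∘ f ≡ h ∘ (g ∘ f)

record Ucwf : Set₁ where
  field
    cat : Category
  open Category cat public
  infixl 8 _[_]
  field
    ⋄      : Obj
    !      : ∀ n → Hom n ⋄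
    !-uniq : ∀ {n} (f : Hom n ⋄) → f ≡ ! n
    Tm     : Obj → Set
    _[_]   : ∀ {m n} → Tm n → Hom m n → Tm m
    [id]   : ∀ {n} (a : Tm n) → a [ id ] ≡ a
    [∘]    : ∀ {k m n} (a : Tm n) (γ : Hom m n) (δ : Hom k m) →
             a [ γ ∘ δ ] ≡ a [ γ ] [ δ ]
    s      : Obj → Obj
    p      : ∀ n → Hom (s n) n
    q      : ∀ n → Tm (s n)
    ⟨_,_⟩  : ∀ {m n} → Hom m n → Tm m → Hom m (s n)
    p∘⟨⟩   : ∀ {m n} (γ : Hom m n) (a : Tm m) → p n ∘ ⟨ γ , a ⟩ ≡ γ
    q[⟨⟩]  : ∀ {m n} (γ : Hom m n) (a : Tm m) → q n [ ⟨ γ , a ⟩ ] ≡ a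
    ⟨⟩-uniq : ∀ {m n} (γ : Hom m n) (a : Tm m) (δ : Hom m (s n)) →
              p n ∘ δ ≡ γ → q n [ δ ] ≡ a → δ ≡ ⟨ γ , a ⟩

record UcwfHom (C D : Ucwf) : Set where
  private
    module C = Ucwf C
    module D = Ucwf D
  field
    F₀    : C.Obj → D.Obj
    F₁    : ∀ {m n} → C.Hom m n → D.Hom (F₀ m) (F₀ n)
    F-id  : ∀ {n} → F₁ (C.id {n}) ≡ D.id
    F-∘   : ∀ {k m n} (g : C.Hom m n) (f : C.Hom k m) →
            F₁ (g C.∘ f) ≡ F₁ g D.∘ F₁ f
    σ     : ∀ {n} → C.Tm n → D.Tm (F₀ n)
    σ-nat : ∀ {m n} (a : C.Tm n) (γ : C.Hom m n) →
            σ (a C.[ γ ]) ≡ σ a D.[ F₁ γ ]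
    F-⋄   : F₀ C.⋄ ≡ D.⋄
    F-s   : ∀ n → F₀ (C.s n) ≡ D.s (F₀ n)
    F-p   : ∀ n → subst (λ X → D.Hom X (F₀ n)) (F-s n) (F₁ (C.p n)) ≡ D.p (F₀ n)
    F-q   : ∀ n → subst D.Tm (F-s n) (σ (C.q n)) ≡ D.q (F₀ n)

record _≈ᵤ_ {C D : Ucwf} (F G : UcwfHom C D) : Set where
  private
    module C = Ucwf C
    module D = Ucwf D
    module F = UcwfHom F
    module G = UcwfHom G
  field
    eq₀ : ∀ n → F.F₀ n ≡ G.F₀ n
    eq₁ : ∀ {m n} (f : C.Hom m n) → subst₂ D.Hom (eq₀ m) (eq₀ n) (F.F₁ f) ≡ G.F₁ f
    eqσ : ∀ {n} (a : C.Tm n) → subst D.Tm (eq₀ n) (F.σ a) ≡ G.σ a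

IsInitial : Ucwf → Set₁
IsInitial I = ∀ (X : Ucwf) → Σ (UcwfHom I X) (λ f → ∀ (g : UcwfHom I X) → g ≈ᵤ f)

HasInitial : Set₁
HasInitial = Σ Ucwf IsInitial

-- Take the numbers n as objects, the de Bruijn indices Fin n as terms in
-- context n, and n-tuples of variables as morphisms m → n, composed by
-- substituting variables.  Into any ucwf X this is interpreted by n ↦ sⁿ ⋄,
-- the index i ↦ q [ pⁱ ], and a tuple ↦ the iterated extension ⟨ … , … ⟩.
-- No other strict morphism exists: strictness fixes the images of 0, s, p
-- and q; every index is q substituted along p's, and every tuple is built
-- from ! and ⟨_,_⟩, whose images are forced by their universal properties.
module Submission where

open import Defs
open import Data.Nat using (ℕ; zero; suc)
open import Data.Fin using (Fin; zero; suc)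
open import Data.Vec using (Vec; []; _∷_; map; lookup; tabulate; allFin)
open import Data.Vec.Properties
  using (map-id; map-cong; map-∘; lookup-map; lookup∘tabulate; tabulate∘lookup;
         tabulate-∘; tabulate-allFin; lookup-allFin; map-lookup-allFin)
open import Data.Product using (_,_)
open import Relation.Binary.PropositionalEquality
  using (_≡_; refl; sym; trans; cong; cong₂; subst; subst₂; module ≡-Reasoning)

module UcwfProperties (X : Ucwf) where
  open Ucwf X

  ⟨⟩-∘ : ∀ {k m n} (γ : Hom m n) (a : Tm m) (δ : Hom k m) →
         ⟨ γ , a ⟩ ∘ δ ≡ ⟨ γ ∘ δ , a [ δ ] ⟩
  ⟨⟩-∘ γ a δ = ⟨⟩-uniq _ _ _
    (trans (sym (assoc _ _ _)) (cong (_∘ δ) (p∘⟨⟩ γ a)))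
    (trans ([∘] _ _ _) (cong (_[ δ ]) (q[⟨⟩] γ a)))

  ⟨p,q⟩≡id : ∀ n → ⟨ p n , q n ⟩ ≡ id
  ⟨p,q⟩≡id n = sym (⟨⟩-uniq _ _ id (idʳ _) ([id] _))

  subst-[] : ∀ {m m′ n n′} (eₘ : m ≡ m′) (eₙ : n ≡ n′) (a : Tm n) (γ : Hom m n) →
             subst Tm eₘ (a [ γ ]) ≡ subst Tm eₙ a [ subst₂ Hom eₘ eₙ γ ]
  subst-[] refl refl a γ = refl

  subst₂-∘ : ∀ {k k′ m m′ n n′} (eₖ : k ≡ k′) (eₘ : m ≡ m′) (eₙ : n ≡ n′)
             (γ : Hom m n) (δ : Hom k m) →
             subst₂ Hom eₖ eₙ (γ ∘ δ) ≡ subst₂ Hom eₘ eₙ γ ∘ subst₂ Hom eₖ eₘ δ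
  subst₂-∘ refl refl refl γ δ = refl

  subst₂-p : ∀ {n n′ m} (eₙ : n ≡ n′) (eₘ : m ≡ s n) (γ : Hom m n) →
             subst (λ k → Hom k n) eₘ γ ≡ p n →
             subst₂ Hom (trans eₘ (cong s eₙ)) eₙ γ ≡ p n′
  subst₂-p refl refl γ γ≡p = γ≡p

  subst-q : ∀ {n n′ m} (eₙ : n ≡ n′) (eₘ : m ≡ s n) (a : Tm m) →
            subst Tm eₘ a ≡ q n → subst Tm (trans eₘ (cong s eₙ)) a ≡ q n′
  subst-q refl refl a a≡q = a≡q

Ren : Category
Ren = record
  { Obj   = ℕ
  ; Hom   = λ m n → Vec (Fin m) n
  ; id    = allFin _
  ; _∘_   = λ γ δ → map (lookup δ) γ
  ; idˡ   = map-lookup-allFin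
  ; idʳ   = λ γ → trans (map-cong lookup-allFin γ) (map-id γ)
  ; assoc = λ γ δ ε → trans (sym (map-∘ (lookup ε) (lookup δ) γ))
                            (map-cong (λ i → sym (lookup-map i (lookup ε) δ)) γ)
  }

weaken : ∀ n → Vec (Fin (suc n)) n
weaken n = tabulate suc

weaken∘∷ : ∀ {m n} (γ : Vec (Fin m) n) (a : Fin m) → map (lookup (a ∷ γ)) (weaken n) ≡ γ
weaken∘∷ γ a = trans (sym (tabulate-∘ (lookup (a ∷ γ)) suc)) (tabulate∘lookup γ)

Vec-0-uniq : ∀ {A : Set} (xs : Vec A 0) → xs ≡ []
Vec-0-uniq [] = refl

∷-uniq : ∀ {m n} (γ : Vec (Fin m) n) (a : Fin m) (δ : Vec (Fin m) (suc n)) →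
         map (lookup δ) (weaken n) ≡ γ → lookup δ zero ≡ a → δ ≡ a ∷ γ
∷-uniq γ a (b ∷ δ) wδ≡γ b≡a = cong₂ _∷_ b≡a (trans (sym (weaken∘∷ δ b)) wδ≡γ)

VarUcwf : Ucwf
VarUcwf = record
  { cat     = Ren
  ; ⋄       = 0
  ; !       = λ _ → []
  ; !-uniq  = Vec-0-uniq
  ; Tm      = Fin
  ; _[_]    = λ i γ → lookup γ i
  ; [id]    = lookup-allFin
  ; [∘]     = λ i γ δ → lookup-map i (lookup δ) γ
  ; s       = suc
  ; p       = weaken
  ; q       = λ _ → zero
  ; ⟨_,_⟩   = λ γ a → a ∷ γ
  ; p∘⟨⟩    = weaken∘∷
  ; q[⟨⟩]   = λ _ _ → refl
  ; ⟨⟩-uniq = ∷-uniq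
  }

module Interpretation (X : Ucwf) where
  open Ucwf X
  open UcwfProperties X

  ⟦_⟧ᶜ : ℕ → Obj
  ⟦ zero ⟧ᶜ  = ⋄
  ⟦ suc n ⟧ᶜ = s ⟦ n ⟧ᶜ

  ⟦_⟧ᵛ : ∀ {n} → Fin n → Tm ⟦ n ⟧ᶜ
  ⟦ zero ⟧ᵛ  = q _
  ⟦ suc i ⟧ᵛ = ⟦ i ⟧ᵛ [ p _ ]

  ⟦_⟧ˢ : ∀ {m n} → Vec (Fin m) n → Hom ⟦ m ⟧ᶜ ⟦ n ⟧ᶜ
  ⟦ [] ⟧ˢ    = ! _
  ⟦ a ∷ γ ⟧ˢ = ⟨ ⟦ γ ⟧ˢ , ⟦ a ⟧ᵛ ⟩

  ⟦lookup⟧ : ∀ {m n} (γ : Vec (Fin m) n) (i : Fin n) → ⟦ lookup γ i ⟧ᵛ ≡ ⟦ i ⟧ᵛ [ ⟦ γ ⟧ˢ ]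
  ⟦lookup⟧ (a ∷ γ) zero    = sym (q[⟨⟩] _ _)
  ⟦lookup⟧ (a ∷ γ) (suc i) = begin
    ⟦ lookup γ i ⟧ᵛ                             ≡⟨ ⟦lookup⟧ γ i ⟩
    ⟦ i ⟧ᵛ [ ⟦ γ ⟧ˢ ]                           ≡⟨ cong (⟦ i ⟧ᵛ [_]) (sym (p∘⟨⟩ _ _)) ⟩
    ⟦ i ⟧ᵛ [ p _ ∘ ⟨ ⟦ γ ⟧ˢ , ⟦ a ⟧ᵛ ⟩ ]         ≡⟨ [∘] _ _ _ ⟩
    ⟦ i ⟧ᵛ [ p _ ] [ ⟨ ⟦ γ ⟧ˢ , ⟦ a ⟧ᵛ ⟩ ]       ∎
    where open ≡-Reasoning

  ⟦∘⟧ : ∀ {k m n} (γ : Vec (Fin m) n) (δ : Vec (Fin k) m) →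
        ⟦ map (lookup δ) γ ⟧ˢ ≡ ⟦ γ ⟧ˢ ∘ ⟦ δ ⟧ˢ
  ⟦∘⟧ []      δ = sym (!-uniq _)
  ⟦∘⟧ (a ∷ γ) δ = trans (cong₂ ⟨_,_⟩ (⟦∘⟧ γ δ) (⟦lookup⟧ δ a)) (sym (⟨⟩-∘ _ _ _))

  ⟦map-suc⟧ : ∀ {m n} (γ : Vec (Fin m) n) → ⟦ map suc γ ⟧ˢ ≡ ⟦ γ ⟧ˢ ∘ p ⟦ m ⟧ᶜ
  ⟦map-suc⟧ []      = sym (!-uniq _)
  ⟦map-suc⟧ (a ∷ γ) = trans (cong ⟨_, ⟦ a ⟧ᵛ [ p _ ] ⟩ (⟦map-suc⟧ γ)) (sym (⟨⟩-∘ _ _ _))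

  ⟦allFin⟧ : ∀ n → ⟦ allFin n ⟧ˢ ≡ id
  ⟦weaken⟧ : ∀ n → ⟦ weaken n ⟧ˢ ≡ p ⟦ n ⟧ᶜ

  ⟦allFin⟧ zero    = sym (!-uniq _)
  ⟦allFin⟧ (suc n) = trans (cong ⟨_, q _ ⟩ (⟦weaken⟧ n)) (⟨p,q⟩≡id _)

  ⟦weaken⟧ n = begin
    ⟦ weaken n ⟧ˢ                  ≡⟨ cong ⟦_⟧ˢ (tabulate-allFin {n = n} suc) ⟩
    ⟦ map suc (allFin n) ⟧ˢ        ≡⟨ ⟦map-suc⟧ (allFin n) ⟩
    ⟦ allFin n ⟧ˢ ∘ p ⟦ n ⟧ᶜ       ≡⟨ cong (_∘ p ⟦ n ⟧ᶜ) (⟦allFin⟧ n) ⟩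
    id ∘ p ⟦ n ⟧ᶜ                  ≡⟨ idˡ _ ⟩
    p ⟦ n ⟧ᶜ                       ∎
    where open ≡-Reasoning

  interpret : UcwfHom VarUcwf X
  interpret = record
    { F₀ = ⟦_⟧ᶜ ; F₁ = ⟦_⟧ˢ ; F-id = λ {n} → ⟦allFin⟧ n ; F-∘ = ⟦∘⟧
    ; σ = ⟦_⟧ᵛ ; σ-nat = λ i γ → ⟦lookup⟧ γ i
    ; F-⋄ = refl ; F-s = λ _ → refl ; F-p = ⟦weaken⟧ ; F-q = λ _ → refl
    }

  module Uniqueness (G : UcwfHom VarUcwf X) where
    open UcwfHom G

    F₀≡⟦⟧ : ∀ n → F₀ n ≡ ⟦ n ⟧ᶜ
    F₀≡⟦⟧ zero    = F-⋄
    F₀≡⟦⟧ (suc n) = trans (F-s n) (cong s (F₀≡⟦⟧ n))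

    transport : ∀ {m n} → Hom (F₀ m) (F₀ n) → Hom ⟦ m ⟧ᶜ ⟦ n ⟧ᶜ
    transport = subst₂ Hom (F₀≡⟦⟧ _) (F₀≡⟦⟧ _)

    F₁-weaken : ∀ n → transport (F₁ (weaken n)) ≡ p ⟦ n ⟧ᶜ
    F₁-weaken n = subst₂-p (F₀≡⟦⟧ n) (F-s n) _ (F-p n)

    σ≡⟦⟧ : ∀ {n} (i : Fin n) → subst Tm (F₀≡⟦⟧ n) (σ i) ≡ ⟦ i ⟧ᵛ
    σ≡⟦⟧ {suc n} zero    = subst-q (F₀≡⟦⟧ n) (F-s n) _ (F-q n)
    σ≡⟦⟧ {suc n} (suc i) = begin
      subst Tm (F₀≡⟦⟧ (suc n)) (σ (suc i))
        ≡⟨ cong (λ j → subst Tm (F₀≡⟦⟧ (suc n)) (σ j)) (sym (lookup∘tabulate suc i)) ⟩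
      subst Tm (F₀≡⟦⟧ (suc n)) (σ (lookup (weaken n) i))
        ≡⟨ cong (subst Tm (F₀≡⟦⟧ (suc n))) (σ-nat i (weaken n)) ⟩
      subst Tm (F₀≡⟦⟧ (suc n)) (σ i [ F₁ (weaken n) ])
        ≡⟨ subst-[] (F₀≡⟦⟧ (suc n)) (F₀≡⟦⟧ n) _ _ ⟩
      subst Tm (F₀≡⟦⟧ n) (σ i) [ transport (F₁ (weaken n)) ]
        ≡⟨ cong₂ _[_] (σ≡⟦⟧ i) (F₁-weaken n) ⟩
      ⟦ i ⟧ᵛ [ p _ ] ∎
      where open ≡-Reasoning

    F₁≡⟦⟧ : ∀ {m n} (γ : Vec (Fin m) n) → transport (F₁ γ) ≡ ⟦ γ ⟧ˢ
    F₁≡⟦⟧ []      = trans (!-uniq _) (sym (!-uniq _))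
    F₁≡⟦⟧ (a ∷ γ) = ⟨⟩-uniq _ _ _ p∘F₁ q[F₁]
      where
      open ≡-Reasoning
      p∘F₁ : p _ ∘ transport (F₁ (a ∷ γ)) ≡ ⟦ γ ⟧ˢ
      p∘F₁ = begin
        p _ ∘ transport (F₁ (a ∷ γ))
          ≡⟨ cong (_∘ transport (F₁ (a ∷ γ))) (sym (F₁-weaken _)) ⟩
        transport (F₁ (weaken _)) ∘ transport (F₁ (a ∷ γ))
          ≡⟨ sym (subst₂-∘ (F₀≡⟦⟧ _) (F₀≡⟦⟧ _) (F₀≡⟦⟧ _) _ _) ⟩
        transport (F₁ (weaken _) ∘ F₁ (a ∷ γ))
          ≡⟨ cong transport (sym (F-∘ (weaken _) (a ∷ γ))) ⟩
        transport (F₁ (map (lookup (a ∷ γ)) (weaken _)))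
          ≡⟨ cong (λ δ → transport (F₁ δ)) (weaken∘∷ γ a) ⟩
        transport (F₁ γ)
          ≡⟨ F₁≡⟦⟧ γ ⟩
        ⟦ γ ⟧ˢ ∎
      q[F₁] : q _ [ transport (F₁ (a ∷ γ)) ] ≡ ⟦ a ⟧ᵛ
      q[F₁] = begin
        q _ [ transport (F₁ (a ∷ γ)) ]
          ≡⟨ cong (_[ transport (F₁ (a ∷ γ)) ]) (sym (σ≡⟦⟧ {suc _} zero)) ⟩
        subst Tm (F₀≡⟦⟧ (suc _)) (σ zero) [ transport (F₁ (a ∷ γ)) ]
          ≡⟨ sym (subst-[] (F₀≡⟦⟧ _) (F₀≡⟦⟧ (suc _)) _ _) ⟩
        subst Tm (F₀≡⟦⟧ _) (σ zero [ F₁ (a ∷ γ) ])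
          ≡⟨ cong (subst Tm (F₀≡⟦⟧ _)) (sym (σ-nat zero (a ∷ γ))) ⟩
        subst Tm (F₀≡⟦⟧ _) (σ a)
          ≡⟨ σ≡⟦⟧ a ⟩
        ⟦ a ⟧ᵛ ∎

    ≈interpret : G ≈ᵤ interpret
    ≈interpret = record { eq₀ = F₀≡⟦⟧ ; eq₁ = F₁≡⟦⟧ ; eqσ = σ≡⟦⟧ }

proposition1 : HasInitial
proposition1 = VarUcwf , λ X → Interpretation.interpret X
                             , λ G → Interpretation.Uniqueness.≈interpret X G
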